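{- For all integers $a,b\ge 2$, \[R(a,b)\le R_{S_2}(2a,2b)\le\left\lceil \tfrac12 R(2a,2b)\right\rceil.\]
   Context: A $2$-edge-coloured complete graph has each edge coloured $1$ or $2$. Switching at a vertex $v$ with the non-identity element of $S_2$ swaps colours $1$ and $2$ on all edges incident with $v$. Two $2$-edge-coloured complete graphs on the same vertex set are $S_2$-switch equivalent if one is obtained from the other by a finite sequence of such switches. $R_{S_2}(a,b)$ is the least integer $n$ such that every $2$-edge-coloured complete graph on $n$ vertices is $S_2$-switch equivalent to one containing a complete subgraph on $a$ vertices with all edges of colour $1$ or a complete subgraph on $b$ vertices with all edges of colour $2$. $R(a,b)$ is the classical two-colour Ramsey number. -}

module Defs where

open import Data.Nat using (ℕ; _≤_)
open import Data.Fin using (Fin; _≟_)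
open import Data.List using (List; foldr)
open import Data.Product using (Σ; _×_; ∃)
open import Data.Sum using (_⊎_)
open import Relation.Nullary using (¬_; does)
open import Relation.Binary.PropositionalEquality using (_≡_)
open import Data.Bool using (Bool; _∨_; if_then_else_)
open import Function.Definitions using (Injective)

data Colour : Set where
  c1 c2 : Colour

swap : Colour → Colour
swap c1 = c2
swap c2 = c1

-- an edge colouring of the complete graph K_n on vertex set Fin n:
-- the colour of edge {x,y} (x ≢ y) is col x y; values on the diagonal are irrelevant
Colouring : ℕ → Set
Colouring n = Fin n → Fin n → Colour

Symmetric : ∀ {n} → Colouring n → Set
Symmetric {n} col = ∀ (x y : Fin n) → col x y ≡ col y x

switch : ∀ {n} → Fin n → Colouring n → Colouring n
switch v col x y = if does (x ≟ v) ∨ does (y ≟ v) then swap (col x y) else col x y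

switchSeq : ∀ {n} → List (Fin n) → Colouring n → Colouring n
switchSeq vs col = foldr switch col vs

SwitchEquiv : ∀ {n} → Colouring n → Colouring n → Set
SwitchEquiv {n} col col' = ∃ λ (vs : List (Fin n)) → switchSeq vs col ≡ col'

HasMonoClique : ∀ {n} → Colouring n → ℕ → Colour → Set
HasMonoClique {n} col k c =
  Σ (Fin k → Fin n) λ f → Injective _≡_ _≡_ f ×
    (∀ (i j : Fin k) → ¬ (i ≡ j) → col (f i) (f j) ≡ c)

RamseyProp : ℕ → ℕ → ℕ → Set
RamseyProp a b n = ∀ (col : Colouring n) → Symmetric col →
  HasMonoClique col a c1 ⊎ HasMonoClique col b c2

SwitchRamseyProp : ℕ → ℕ → ℕ → Set
SwitchRamseyProp a b n = ∀ (col : Colouring n) → Symmetric col →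
  ∃ λ (col' : Colouring n) → SwitchEquiv col col' ×
    (HasMonoClique col' a c1 ⊎ HasMonoClique col' b c2)

IsLeast : (ℕ → Set) → ℕ → Set
IsLeast P r = P r × (∀ m → P m → r ≤ m)

IsRamseyNumber : ℕ → ℕ → ℕ → Set
IsRamseyNumber a b r = IsLeast (RamseyProp a b) r

IsSwitchRamseyNumber : ℕ → ℕ → ℕ → Set
IsSwitchRamseyNumber a b r = IsLeast (SwitchRamseyProp a b) r

-- A sequence of switches flips exactly the edges whose endpoints were switched with different parity.
-- Lower bound: a monochromatic 2k-clique of a switched colouring has k vertices on the same side
-- of the switching set, and these span a monochromatic k-clique of the original colouring.
-- Upper bound: double every vertex of a colouring on ⌈n/2⌉ vertices into a pair of twins, the
-- second twin seeing every edge flipped. A monochromatic clique of size ≥ 3 in the doubled colouring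
-- cannot contain both twins (a third vertex sees them in opposite colours), so it is a copy of a
-- clique of the original colouring, and switching at the second twins it uses makes that clique
-- monochromatic. Finally every predicate involved is decidable, so the least n exists.
module Submission where

open import Defs
open import Level using (0ℓ)
open import Data.Nat using (ℕ; zero; suc; _≤_; _<_; _+_; _*_; s≤s; z≤n; ⌈_/2⌉)
open import Data.Nat.Properties using (≤-trans; ≤-reflexive; *-monoʳ-≤; +-suc; +-identityʳ; m≤n⇒m≤1+n; ≮⇒≥; anyUpTo?)
open import Data.Nat.Induction using (<-rec)
open import Data.Fin using (Fin; zero; suc; _≟_)
open import Data.Fin.Properties using (suc-injective; any?; all?)
open import Data.Vec using (Vec; []; _∷_; lookup; tabulate)
open import Data.Vec.Properties using (lookup∘tabulate)
open import Data.List using (List; []; _∷_; map)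
open import Data.Product using (Σ; _×_; ∃; _,_)
open import Data.Sum using (_⊎_; inj₁; inj₂; [_,_]′)
import Data.Sum as Sum
open import Data.Bool using (Bool; true; false; not; _xor_; if_then_else_)
open import Data.Bool.Properties using (xor-comm; xor-same; not-distribˡ-xor; not-distribʳ-xor; ¬-not)
  renaming (_≟_ to _≟ᴮ_)
open import Data.Empty using (⊥-elim)
open import Function using (_∘_; _⇔_; mk⇔; Equivalence)
open import Function.Definitions using (Injective)
open import Relation.Nullary using (Dec; yes; no; does; ¬?; _×-dec_; _⊎-dec_; _→-dec_; contradiction)
open import Relation.Nullary.Decidable using (map′; decidable-stable)
open import Relation.Unary using (Pred; Decidable)
open import Relation.Binary using (Rel; _Respects_)
open import Relation.Binary.PropositionalEquality
  using (_≡_; _≢_; _≗_; refl; sym; trans; cong; cong₂; subst; subst₂; module ≡-Reasoning)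

private
  variable
    n k : ℕ

_≟ᶜ_ : (c d : Colour) → Dec (c ≡ d)
c1 ≟ᶜ c1 = yes refl
c1 ≟ᶜ c2 = no λ ()
c2 ≟ᶜ c1 = no λ ()
c2 ≟ᶜ c2 = yes refl

swap-≢ : ∀ c → swap c ≢ c
swap-≢ c1 ()
swap-≢ c2 ()

flipIf : Bool → Colour → Colour
flipIf b c = if b then swap c else c

flipIf-not : ∀ b c → flipIf (not b) c ≡ swap (flipIf b c)
flipIf-not true c1 = refl
flipIf-not true c2 = refl
flipIf-not false c = refl

flipIf-not-xor : ∀ p q c → flipIf (not p xor q) c ≡ swap (flipIf (p xor q) c)
flipIf-not-xor p q c = trans (cong (λ b → flipIf b c) (sym (not-distribˡ-xor p q))) (flipIf-not (p xor q) c)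

flipIf-xor-not : ∀ p q c → flipIf (p xor not q) c ≡ swap (flipIf (p xor q) c)
flipIf-xor-not p q c = trans (cong (λ b → flipIf b c) (sym (not-distribʳ-xor p q))) (flipIf-not (p xor q) c)

flipIf-same : ∀ b c → flipIf (b xor b) c ≡ c
flipIf-same b c = cong (λ d → flipIf d c) (xor-same b)

infix 4 _≋_

_≋_ : Colouring n → Colouring n → Set
col ≋ col′ = ∀ x y → x ≢ y → col x y ≡ col′ x y

≋-sym : {col col′ : Colouring n} → col ≋ col′ → col′ ≋ col
≋-sym eq x y x≢y = sym (eq x y x≢y)

symmetric-resp-≋ : {col col′ : Colouring n} → col ≋ col′ → Symmetric col → Symmetric col′
symmetric-resp-≋ eq sym-col x y with x ≟ y
... | yes refl = refl
... | no x≢y = trans (sym (eq x y x≢y)) (trans (sym-col x y) (eq y x (x≢y ∘ sym)))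

hasMonoClique-resp-≋ : ∀ {col col′ : Colouring n} {c} → col ≋ col′ →
  HasMonoClique col k c → HasMonoClique col′ k c
hasMonoClique-resp-≋ eq (f , f-inj , mono) =
  f , f-inj , λ i j i≢j → trans (sym (eq (f i) (f j) (i≢j ∘ f-inj))) (mono i j i≢j)

parity : List (Fin n) → Fin n → Bool
parity []       x = false
parity (v ∷ vs) x = does (x ≟ v) xor parity vs x

switchSeq-parity : ∀ (vs : List (Fin n)) col x y → x ≢ y →
  switchSeq vs col x y ≡ flipIf (parity vs x xor parity vs y) (col x y)
switchSeq-parity []       col x y x≢y = refl
switchSeq-parity (v ∷ vs) col x y x≢y with x ≟ v | y ≟ v
... | yes refl | yes refl = contradiction refl x≢y
... | yes refl | no _ =
  trans (cong swap (switchSeq-parity vs col x y x≢y)) (sym (flipIf-not-xor (parity vs x) (parity vs y) (col x y)))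
... | no _ | yes refl =
  trans (cong swap (switchSeq-parity vs col x y x≢y)) (sym (flipIf-xor-not (parity vs x) (parity vs y) (col x y)))
... | no _ | no _ = switchSeq-parity vs col x y x≢y

switchSeq-resp-≋ : ∀ (vs : List (Fin n)) {col col′} → col ≋ col′ → switchSeq vs col ≋ switchSeq vs col′
switchSeq-resp-≋ vs {col} {col′} eq x y x≢y = begin
  switchSeq vs col x y                                     ≡⟨ switchSeq-parity vs col x y x≢y ⟩
  flipIf (parity vs x xor parity vs y) (col x y)           ≡⟨ cong (flipIf _) (eq x y x≢y) ⟩
  flipIf (parity vs x xor parity vs y) (col′ x y)          ≡⟨ switchSeq-parity vs col′ x y x≢y ⟨
  switchSeq vs col′ x y                                    ∎
  where open ≡-Reasoning

switchSeq-sameParity : ∀ (vs : List (Fin n)) col {x y} → x ≢ y →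
  parity vs x ≡ parity vs y → switchSeq vs col x y ≡ col x y
switchSeq-sameParity vs col {x} {y} x≢y same = begin
  switchSeq vs col x y                              ≡⟨ switchSeq-parity vs col x y x≢y ⟩
  flipIf (parity vs x xor parity vs y) (col x y)    ≡⟨ cong (λ b → flipIf (parity vs x xor b) (col x y)) same ⟨
  flipIf (parity vs x xor parity vs x) (col x y)    ≡⟨ flipIf-same (parity vs x) (col x y) ⟩
  col x y                                           ∎
  where open ≡-Reasoning

switchingSet : Vec Bool n → List (Fin n)
switchingSet []      = []
switchingSet (b ∷ S) = if b then zero ∷ rest else rest
  where rest = map suc (switchingSet S)

parity-map-suc-zero : ∀ (vs : List (Fin n)) → parity (map suc vs) zero ≡ false
parity-map-suc-zero []       = refl
parity-map-suc-zero (v ∷ vs) = parity-map-suc-zero vs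

parity-map-suc : ∀ (vs : List (Fin n)) x → parity (map suc vs) (suc x) ≡ parity vs x
parity-map-suc []       x = refl
parity-map-suc (v ∷ vs) x = cong (does (x ≟ v) xor_) (parity-map-suc vs x)

parity-switchingSet : ∀ (S : Vec Bool n) x → parity (switchingSet S) x ≡ lookup S x
parity-switchingSet (true ∷ S)  zero    = cong not (parity-map-suc-zero (switchingSet S))
parity-switchingSet (false ∷ S) zero    = parity-map-suc-zero (switchingSet S)
parity-switchingSet (true ∷ S)  (suc x) = trans (parity-map-suc (switchingSet S) x) (parity-switchingSet S x)
parity-switchingSet (false ∷ S) (suc x) = trans (parity-map-suc (switchingSet S) x) (parity-switchingSet S x)

switchSeq-switchingSet : ∀ (S : Vec Bool n) col x y → x ≢ y →
  switchSeq (switchingSet S) col x y ≡ flipIf (lookup S x xor lookup S y) (col x y)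
switchSeq-switchingSet S col x y x≢y =
  trans (switchSeq-parity (switchingSet S) col x y x≢y)
        (cong₂ (λ p q → flipIf (p xor q) (col x y)) (parity-switchingSet S x) (parity-switchingSet S y))

Fibre≥ : (Fin n → Bool) → Bool → ℕ → Set
Fibre≥ {n} β b k = Σ (Fin k → Fin n) λ g → Injective _≡_ _≡_ g × (∀ i → β (g i) ≡ b)

fibre≥-zero : ∀ (β : Fin n → Bool) b → Fibre≥ β b 0
fibre≥-zero β b = (λ ()) , (λ { {()} }) , λ ()

fibre≥-cons : ∀ {β : Fin (suc n) → Bool} {b} → β zero ≡ b → Fibre≥ (β ∘ suc) b k → Fibre≥ β b (suc k)
fibre≥-cons {n} {k} {β} {b} β₀ (g , g-inj , g-fib) = g′ , g′-inj , g′-fib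
  where
  g′ : Fin (suc k) → Fin (suc n)
  g′ zero    = zero
  g′ (suc i) = suc (g i)
  g′-inj : Injective _≡_ _≡_ g′
  g′-inj {zero}  {zero}  _  = refl
  g′-inj {suc i} {suc j} eq = cong suc (g-inj (suc-injective eq))
  g′-fib : ∀ i → β (g′ i) ≡ b
  g′-fib zero    = β₀
  g′-fib (suc i) = g-fib i

fibre≥-suc : ∀ {β : Fin (suc n) → Bool} {b} → Fibre≥ (β ∘ suc) b k → Fibre≥ β b k
fibre≥-suc (g , g-inj , g-fib) = suc ∘ g , g-inj ∘ suc-injective , g-fib

bool-pigeonhole : ∀ n (β : Fin n → Bool) k l → k + l ≤ suc n → Fibre≥ β true k ⊎ Fibre≥ β false l
bool-pigeonhole n β zero l _ = inj₁ (fibre≥-zero β true)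
bool-pigeonhole n β (suc k) zero _ = inj₂ (fibre≥-zero β false)
bool-pigeonhole zero β (suc k) (suc l) (s≤s k+1+l≤0) with () ← subst (_≤ 0) (+-suc k l) k+1+l≤0
bool-pigeonhole (suc n) β (suc k) (suc l) (s≤s k+1+l≤1+n) with β zero in β₀
... | true with bool-pigeonhole n (β ∘ suc) k (suc l) k+1+l≤1+n
...   | inj₁ fib = inj₁ (fibre≥-cons {β = β} β₀ fib)
...   | inj₂ fib = inj₂ (fibre≥-suc {β = β} fib)
bool-pigeonhole (suc n) β (suc k) (suc l) (s≤s k+1+l≤1+n) | false
  with bool-pigeonhole n (β ∘ suc) (suc k) l (subst (_≤ suc n) (+-suc k l) k+1+l≤1+n)
...   | inj₁ fib = inj₁ (fibre≥-suc {β = β} fib)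
...   | inj₂ fib = inj₂ (fibre≥-cons {β = β} β₀ fib)

hasMonoClique-unswitch : ∀ (vs : List (Fin n)) col {c} →
  HasMonoClique (switchSeq vs col) (2 * k) c → HasMonoClique col k c
hasMonoClique-unswitch {k = k} vs col {c} (f , f-inj , f-mono) =
  [ sameParityClique , sameParityClique ]′ (bool-pigeonhole (2 * k) (parity vs ∘ f) k k k+k≤1+2k)
  where
  k+k≤1+2k : k + k ≤ suc (2 * k)
  k+k≤1+2k = m≤n⇒m≤1+n (≤-reflexive (cong (k +_) (sym (+-identityʳ k))))
  sameParityClique : ∀ {b} → Fibre≥ (parity vs ∘ f) b k → HasMonoClique col k c
  sameParityClique (g , g-inj , g-fib) = f ∘ g , g-inj ∘ f-inj , λ i j i≢j →
    trans (sym (switchSeq-sameParity vs col (i≢j ∘ g-inj ∘ f-inj) (trans (g-fib i) (sym (g-fib j)))))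
          (f-mono (g i) (g j) (i≢j ∘ g-inj))

switchRamsey⇒ramsey : ∀ a b m → SwitchRamseyProp (2 * a) (2 * b) m → RamseyProp a b m
switchRamsey⇒ramsey a b m srp col sym-col with srp col sym-col
... | _ , (vs , refl) , inj₁ clique = inj₁ (hasMonoClique-unswitch vs col clique)
... | _ , (vs , refl) , inj₂ clique = inj₂ (hasMonoClique-unswitch vs col clique)

three-distinct : 3 ≤ k → (i j : Fin k) → ∃ λ l → l ≢ i × l ≢ j
three-distinct (s≤s (s≤s (s≤s _))) i j with i ≟ zero | j ≟ zero
... | no i≢0 | no j≢0 = zero , i≢0 ∘ sym , j≢0 ∘ sym
... | yes refl | _ with j ≟ suc zero
...   | no j≢1 = suc zero , (λ ()) , j≢1 ∘ sym
...   | yes refl = suc (suc zero) , (λ ()) , (λ ())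
three-distinct (s≤s (s≤s (s≤s _))) i j | no i≢0 | yes refl with i ≟ suc zero
...   | no i≢1 = suc zero , i≢1 ∘ sym , (λ ())
...   | yes refl = suc (suc zero) , (λ ()) , (λ ())

-- A point i of the clique stands for the vertex E i of col, switched iff B i holds.
switchedMonoClique : ∀ (col : Colouring n) c → 3 ≤ k → (E : Fin k → Fin n) (B : Fin k → Bool) →
  (∀ i j → E i ≡ E j → B i ≡ B j → i ≡ j) →
  (∀ i j → i ≢ j → flipIf (B i xor B j) (col (E i) (E j)) ≡ c) →
  ∃ λ (S : Vec Bool n) → HasMonoClique (switchSeq (switchingSet S) col) k c
switchedMonoClique {n} {k} col c 3≤k E B twin-inj mono = S , E , E-inj , switched-mono
  where
  E-inj : Injective _≡_ _≡_ E
  E-inj {i} {j} Ei≡Ej with i ≟ j | B i ≟ᴮ B j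
  ... | yes i≡j | _ = i≡j
  ... | no _ | yes Bi≡Bj = twin-inj i j Ei≡Ej Bi≡Bj
  ... | no i≢j | no Bi≢Bj with l , l≢i , l≢j ← three-distinct 3≤k i j =
    ⊥-elim (swap-≢ c (begin
      swap c                                          ≡⟨ cong swap (mono j l (l≢j ∘ sym)) ⟨
      swap (flipIf (B j xor B l) (col (E j) (E l)))   ≡⟨ flipIf-not-xor (B j) (B l) _ ⟨
      flipIf (not (B j) xor B l) (col (E j) (E l))    ≡⟨ cong₂ (λ b e → flipIf (b xor B l) (col e (E l)))
                                                                (¬-not Bi≢Bj) Ei≡Ej ⟨
      flipIf (B i xor B l) (col (E i) (E l))          ≡⟨ mono i l (l≢i ∘ sym) ⟩
      c                                               ∎))
    where open ≡-Reasoning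

  S : Vec Bool n
  S = tabulate λ x → does (any? λ i → E i ≟ x ×-dec B i ≟ᴮ true)

  S-E : ∀ i → lookup S (E i) ≡ B i
  S-E i rewrite lookup∘tabulate (λ x → does (any? λ i → E i ≟ x ×-dec B i ≟ᴮ true)) (E i)
    with any? (λ j → E j ≟ E i ×-dec B j ≟ᴮ true)
  ... | yes (j , Ej≡Ei , Bj) = trans (sym Bj) (cong B (E-inj Ej≡Ei))
  ... | no none with B i in Bi
  ...   | true = contradiction (i , refl , Bi) none
  ...   | false = refl

  switched-mono : ∀ i j → i ≢ j → switchSeq (switchingSet S) col (E i) (E j) ≡ c
  switched-mono i j i≢j = begin
    switchSeq (switchingSet S) col (E i) (E j)
      ≡⟨ switchSeq-switchingSet S col _ _ (i≢j ∘ E-inj) ⟩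
    flipIf (lookup S (E i) xor lookup S (E j)) (col (E i) (E j))
      ≡⟨ cong₂ (λ p q → flipIf (p xor q) _) (S-E i) (S-E j) ⟩
    flipIf (B i xor B j) (col (E i) (E j))
      ≡⟨ mono i j i≢j ⟩
    c ∎
    where open ≡-Reasoning

-- Vertex i of the doubled colouring is the twin twinSide i of the vertex twinClass i = ⌊i/2⌋.
twinClass : Fin k → Fin ⌈ k /2⌉
twinClass {suc zero}    zero          = zero
twinClass {suc (suc k)} zero          = zero
twinClass {suc (suc k)} (suc zero)    = zero
twinClass {suc (suc k)} (suc (suc i)) = suc (twinClass i)

twinSide : Fin k → Bool
twinSide {suc zero}    zero          = false
twinSide {suc (suc k)} zero          = false
twinSide {suc (suc k)} (suc zero)    = true
twinSide {suc (suc k)} (suc (suc i)) = twinSide i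

twin-injective : ∀ (i j : Fin k) → twinClass i ≡ twinClass j → twinSide i ≡ twinSide j → i ≡ j
twin-injective {suc zero}    zero          zero          _  _ = refl
twin-injective {suc (suc k)} zero          zero          _  _ = refl
twin-injective {suc (suc k)} zero          (suc zero)    _  ()
twin-injective {suc (suc k)} zero          (suc (suc j)) () _
twin-injective {suc (suc k)} (suc zero)    zero          _  ()
twin-injective {suc (suc k)} (suc zero)    (suc zero)    _  _ = refl
twin-injective {suc (suc k)} (suc zero)    (suc (suc j)) () _
twin-injective {suc (suc k)} (suc (suc i)) zero          () _
twin-injective {suc (suc k)} (suc (suc i)) (suc zero)    () _
twin-injective {suc (suc k)} (suc (suc i)) (suc (suc j)) eq same =
  cong (λ z → suc (suc z)) (twin-injective i j (suc-injective eq) same)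

doubled : Colouring ⌈ n /2⌉ → Colouring n
doubled col i j = flipIf (twinSide i xor twinSide j) (col (twinClass i) (twinClass j))

doubled-symmetric : ∀ (col : Colouring ⌈ n /2⌉) → Symmetric col → Symmetric (doubled col)
doubled-symmetric col sym-col i j =
  cong₂ flipIf (xor-comm (twinSide i) (twinSide j)) (sym-col (twinClass i) (twinClass j))

doubledClique⇒switchedClique : ∀ (col : Colouring ⌈ n /2⌉) c → 3 ≤ k → HasMonoClique (doubled col) k c →
  ∃ λ S → HasMonoClique (switchSeq (switchingSet S) col) k c
doubledClique⇒switchedClique col c 3≤k (F , F-inj , mono) =
  switchedMonoClique col c 3≤k (twinClass ∘ F) (twinSide ∘ F)
    (λ i j sameClass sameSide → F-inj (twin-injective (F i) (F j) sameClass sameSide)) mono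

ramsey⇒switchRamsey-half : ∀ {p q} → 3 ≤ p → 3 ≤ q → RamseyProp p q n → SwitchRamseyProp p q ⌈ n /2⌉
ramsey⇒switchRamsey-half 3≤p 3≤q rp col sym-col with rp (doubled col) (doubled-symmetric col sym-col)
... | inj₁ clique with S , switched ← doubledClique⇒switchedClique col c1 3≤p clique =
  _ , (switchingSet S , refl) , inj₁ switched
... | inj₂ clique with S , switched ← doubledClique⇒switchedClique col c2 3≤q clique =
  _ , (switchingSet S , refl) , inj₂ switched

Exhaustible : Set → Set₁
Exhaustible A = ∀ {P : Pred A 0ℓ} → Decidable P → Dec (∃ P)

exhaustible-Bool : Exhaustible Bool
exhaustible-Bool P? = map′ [ (true ,_) , (false ,_) ]′ (λ { (true , p) → inj₁ p ; (false , p) → inj₂ p })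
  (P? true ⊎-dec P? false)

exhaustible-Colour : Exhaustible Colour
exhaustible-Colour P? = map′ [ (c1 ,_) , (c2 ,_) ]′ (λ { (c1 , p) → inj₁ p ; (c2 , p) → inj₂ p })
  (P? c1 ⊎-dec P? c2)

exhaustible-Vec : ∀ {A} → Exhaustible A → ∀ k → Exhaustible (Vec A k)
exhaustible-Vec exhaust zero    P? = map′ ([] ,_) (λ { ([] , p) → p }) (P? [])
exhaustible-Vec exhaust (suc k) P? =
  map′ (λ (a , v , p) → a ∷ v , p) (λ { (a ∷ v , p) → a , v , p })
    (exhaust λ a → exhaustible-Vec exhaust k λ v → P? (a ∷ v))

-- Searching A through a map e : B → A that is onto up to a relation respected by the predicate;
-- needed for functions, where pointwise equality is not _≡_ without function extensionality.
module _ {A B : Set} (exhaust : Exhaustible B) (e : B → A) {_≈_ : Rel A 0ℓ}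
         (≈-sym : ∀ {a a′} → a ≈ a′ → a′ ≈ a) (cover : ∀ a → ∃ λ b → a ≈ e b)
         {P : Pred A 0ℓ} (resp : P Respects _≈_) (P? : Decidable P) where

  ∃-cover? : Dec (∃ P)
  ∃-cover? = map′ (λ (b , p) → e b , p) (λ (a , p) → let b , a≈eb = cover a in b , resp a≈eb p)
    (exhaust (P? ∘ e))

  ∀-cover? : Dec (∀ a → P a)
  ∀-cover? = map′
    (λ none a → let b , a≈eb = cover a in
      resp (≈-sym a≈eb) (decidable-stable (P? (e b)) λ ¬p → none (b , ¬p)))
    (λ all (b , ¬p) → ¬p (all (e b)))
    (¬? (exhaust (¬? ∘ P? ∘ e)))

injective? : ∀ (f : Fin k → Fin n) → Dec (Injective _≡_ _≡_ f)
injective? f = map′ (λ inj {i} {j} → inj i j) (λ inj i j → inj)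
  (all? λ i → all? λ j → f i ≟ f j →-dec i ≟ j)

hasMonoClique? : ∀ (col : Colouring n) k c → Dec (HasMonoClique col k c)
hasMonoClique? {n} col k c =
  ∃-cover? (exhaustible-Vec any? k) lookup (λ f≗g → sym ∘ f≗g) (λ f → tabulate f , sym ∘ lookup∘tabulate f)
    resp (λ f → injective? f ×-dec (all? λ i → all? λ j → ¬? (i ≟ j) →-dec col (f i) (f j) ≟ᶜ c))
  where
  resp : ∀ {f g : Fin k → Fin n} → f ≗ g →
    Injective _≡_ _≡_ f × (∀ i j → i ≢ j → col (f i) (f j) ≡ c) →
    Injective _≡_ _≡_ g × (∀ i j → i ≢ j → col (g i) (g j) ≡ c)
  resp f≗g (f-inj , mono) =
    (λ {i} {j} gi≡gj → f-inj (trans (f≗g i) (trans gi≡gj (sym (f≗g j))))) ,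
    λ i j i≢j → subst₂ (λ x y → col x y ≡ c) (f≗g i) (f≗g j) (mono i j i≢j)

symmetric? : ∀ (col : Colouring n) → Dec (Symmetric col)
symmetric? col = all? λ x → all? λ y → col x y ≟ᶜ col y x

RamseyConclusion : ℕ → ℕ → Colouring n → Set
RamseyConclusion p q col = HasMonoClique col p c1 ⊎ HasMonoClique col q c2

ramseyConclusion? : ∀ p q (col : Colouring n) → Dec (RamseyConclusion p q col)
ramseyConclusion? p q col = hasMonoClique? col p c1 ⊎-dec hasMonoClique? col q c2

ramseyConclusion-resp-≋ : ∀ {p q} {col col′ : Colouring n} → col ≋ col′ →
  RamseyConclusion p q col → RamseyConclusion p q col′
ramseyConclusion-resp-≋ eq = Sum.map (hasMonoClique-resp-≋ eq) (hasMonoClique-resp-≋ eq)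

SwitchableBySubset : ℕ → ℕ → Colouring n → Set
SwitchableBySubset {n} p q col =
  Symmetric col → ∃ λ (S : Vec Bool n) → RamseyConclusion p q (switchSeq (switchingSet S) col)

switchSeq-≋-switchingSet : ∀ (vs : List (Fin n)) col →
  switchSeq vs col ≋ switchSeq (switchingSet (tabulate (parity vs))) col
switchSeq-≋-switchingSet vs col x y x≢y = begin
  switchSeq vs col x y
    ≡⟨ switchSeq-parity vs col x y x≢y ⟩
  flipIf (parity vs x xor parity vs y) (col x y)
    ≡⟨ cong₂ (λ p q → flipIf (p xor q) (col x y)) (lookup∘tabulate (parity vs) x) (lookup∘tabulate (parity vs) y) ⟨
  flipIf (lookup S x xor lookup S y) (col x y)
    ≡⟨ switchSeq-switchingSet S col x y x≢y ⟨
  switchSeq (switchingSet S) col x y ∎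
  where open ≡-Reasoning; S = tabulate (parity vs)

-- Only the parity of the switches matters, which makes the search for a switching sequence finite.
switchRamsey⇔switchableBySubset : ∀ p q m → SwitchRamseyProp p q m ⇔ (∀ col → SwitchableBySubset {m} p q col)
switchRamsey⇔switchableBySubset p q m = mk⇔ to from
  where
  to : SwitchRamseyProp p q m → ∀ col → SwitchableBySubset p q col
  to srp col sym-col with _ , (vs , refl) , conclusion ← srp col sym-col =
    tabulate (parity vs) , ramseyConclusion-resp-≋ (switchSeq-≋-switchingSet vs col) conclusion
  from : (∀ col → SwitchableBySubset p q col) → SwitchRamseyProp p q m
  from switchable col sym-col with S , conclusion ← switchable col sym-col =
    _ , (switchingSet S , refl) , conclusion

switchRamseyProp? : ∀ p q m → Dec (SwitchRamseyProp p q m)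
switchRamseyProp? p q m = map′ from to
  (∀-cover? (exhaustible-Vec (exhaustible-Vec exhaustible-Colour m) m) (λ t x y → lookup (lookup t x) y) ≋-sym
    (λ col → tabulate (tabulate ∘ col) , λ x y _ → sym (lookup∘tabulate² col x y))
    resp switchable?)
  where
  open Equivalence (switchRamsey⇔switchableBySubset p q m)
  lookup∘tabulate² : ∀ (col : Colouring m) x y → lookup (lookup (tabulate (tabulate ∘ col)) x) y ≡ col x y
  lookup∘tabulate² col x y =
    trans (cong (λ row → lookup row y) (lookup∘tabulate (tabulate ∘ col) x)) (lookup∘tabulate (col x) y)
  resp : ∀ {col col′} → col ≋ col′ → SwitchableBySubset p q col → SwitchableBySubset p q col′
  resp eq switchable sym-col′ with S , conclusion ← switchable (symmetric-resp-≋ (≋-sym eq) sym-col′) =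
    S , ramseyConclusion-resp-≋ (switchSeq-resp-≋ (switchingSet S) eq) conclusion
  switchable? : ∀ col → Dec (SwitchableBySubset p q col)
  switchable? col = symmetric? col →-dec
    exhaustible-Vec exhaustible-Bool m (λ S → ramseyConclusion? p q (switchSeq (switchingSet S) col))

∃-least : ∀ {P : Pred ℕ 0ℓ} → Decidable P → ∀ n → P n → ∃ (IsLeast P)
∃-least {P} P? = <-rec (λ n → P n → ∃ (IsLeast P)) search
  where
  search : ∀ n → (∀ {m} → m < n → P m → ∃ (IsLeast P)) → P n → ∃ (IsLeast P)
  search n smaller pn with anyUpTo? P? n
  ... | yes (m , m<n , pm) = smaller m<n pm
  ... | no none = n , pn , λ m pm → ≮⇒≥ λ m<n → none (m , m<n , pm)

corollary5 : ∀ (a b : ℕ) → 2 ≤ a → 2 ≤ b →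
    ∀ (r r₂ : ℕ) → IsRamseyNumber a b r → IsRamseyNumber (2 * a) (2 * b) r₂ →
    ∃ λ (s : ℕ) → IsSwitchRamseyNumber (2 * a) (2 * b) s ×
    (r ≤ s × s ≤ ⌈ r₂ /2⌉)
corollary5 a b 2≤a 2≤b r r₂ (_ , r-least) (ramsey-r₂ , _) =
  let s , switchRamsey-s , s-least = ∃-least (switchRamseyProp? (2 * a) (2 * b)) ⌈ r₂ /2⌉ switchRamsey-half
  in s , (switchRamsey-s , s-least) , r-least s (switchRamsey⇒ramsey a b s switchRamsey-s) , s-least _ switchRamsey-half
  where
  3≤2* : ∀ {x} → 2 ≤ x → 3 ≤ 2 * x
  3≤2* 2≤x = ≤-trans (s≤s (s≤s (s≤s z≤n))) (*-monoʳ-≤ 2 2≤x)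
  switchRamsey-half : SwitchRamseyProp (2 * a) (2 * b) ⌈ r₂ /2⌉
  switchRamsey-half = ramsey⇒switchRamsey-half (3≤2* 2≤a) (3≤2* 2≤b) ramsey-r₂
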